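{- Let $N\in\mathbb{N}$. For $z, c\neq q^{ -n}$, $1\leq n\leq N$, \begin{equation*} \sum_{n=1}^{N}\genfrac{[}{]}{0pt}{}{N}{n}\frac{(-1)^{n-1}z^nq^{\frac{n(n+1)}{2}}(q)_{n}}{(1-cq^{n})(zq)_n}= \frac{z}{c}\sum_{n=1}^{N}\genfrac{[}{]}{0pt}{}{N}{n}\frac{(zq/c)_{n-1}(q)_{n} (cq)_{N-n} (cq)^{n}}{(zq)_{n}(cq)_{N}}. \end{equation*}
   Context: Here $|q|<1$, $(A)_n=(A;q)_n=(1-A)(1-Aq)\cdots(1-Aq^{n-1})$ with $(A)_0=1$, and $\genfrac{[}{]}{0pt}{}{N}{n}=\frac{(q;q)_N}{(q;q)_n(q;q)_{N-n}}$ for $0\le n\le N$ is the $q$-binomial coefficient. -}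

module Defs where

open import Level using (Level; _⊔_) renaming (suc to lsuc)
open import Algebra.Bundles using (CommutativeRing)
open import Data.Nat using (ℕ; zero; suc; _∸_; _≤_)
import Data.Nat as ℕ
open import Relation.Nullary using (¬_)

-- A field: a commutative ring with 0 ≠ 1 and a (total) inverse operation
-- that is a genuine inverse on nonzero elements (its value at 0 is irrelevant
-- and never used, since every denominator below is assumed nonzero).
record Field (c ℓ : Level) : Set (lsuc (c ⊔ ℓ)) where
  field
    commutativeRing : CommutativeRing c ℓ
  open CommutativeRing commutativeRing public
  field
    _⁻¹     : Carrier → Carrier
    ⁻¹-cong : ∀ {x y} → x ≈ y → x ⁻¹ ≈ y ⁻¹
    inverse : ∀ x → ¬ (x ≈ 0#) → x * (x ⁻¹) ≈ 1#
    0≉1     : ¬ (0# ≈ 1#)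

module FieldOps {c ℓ : Level} (F : Field c ℓ) where
  open Field F

  infixl 7 _÷_
  _÷_ : Carrier → Carrier → Carrier
  a ÷ b = a * (b ⁻¹)

  pow : Carrier → ℕ → Carrier
  pow x zero    = 1#
  pow x (suc n) = pow x n * x

  poch : (q a : Carrier) → ℕ → Carrier
  poch q a zero    = 1#
  poch q a (suc n) = poch q a n * (1# - a * pow q n)

  -- q-binomial coefficient [N n] = (q;q)_N / ((q;q)_n (q;q)_{N-n})  (used for n ≤ N)
  qbinom : (q : Carrier) → ℕ → ℕ → Carrier
  qbinom q N n = poch q q N ÷ (poch q q n * poch q q (N ∸ n))

  sum1 : ℕ → (ℕ → Carrier) → Carrier
  sum1 zero    f = 0#
  sum1 (suc N) f = sum1 N f + f (suc N)

  tri : ℕ → ℕ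
  tri n = (n ℕ.* suc n) ℕ./ 2

module Submission where

-- Write L_N(z, c) for the
-- left-hand sum and R_N(z, c) for z/c times the right-hand sum.  Splitting
-- off the term n = 1 and comparing the n-th term at N = M+1 with the
-- (n-1)-th term at N = M gives the recursions
--   L_{M+1}(z, c) = K_M(z) (1/(1 - cq) - L_M(zq, cq)),
--   R_{M+1}(z, c) = α_M(z, c) (zq + (c - zq) R_M(zq, c)),
-- with K_M(z) = zq(1 - q^{M+1})/(1 - zq) and
-- α_M(z, c) = (1 - q^{M+1})/((1 - cq^{M+1})(1 - zq)).  Both start at 0, so
-- the theorem reduces to showing that the functions ℒ, ℛ defined by these
-- recursions coincide; this follows by induction from a contiguous relation
-- of ℛ in c, itself proved by induction.  The
-- hypotheses q^j ≠ 1, zq^n ≠ 1, cq^n ≠ 1, c ≠ 0 make every denominator nonzero.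

open import Level using (Level)
open import Algebra.Bundles using (CommutativeRing)
open import Data.Nat using (ℕ; zero; suc; z≤n; s≤s; _≤_; _∸_)
import Data.Nat as ℕ
import Data.Nat.Properties as ℕP
open import Data.Nat.DivMod using (+-distrib-/-∣ʳ; m*n/n≡m)
open import Data.Nat.Divisibility using (divides-refl)
open import Data.Nat.Tactic.RingSolver using (solve-∀)
open import Data.Integer using (ℤ; +_; -[1+_]; _⊖_)
import Data.Integer as ℤ
import Data.Integer.Properties as ℤP
open import Data.Sign using (Sign)
import Data.Sign as Sign
open import Data.Maybe using (Maybe; just; nothing)
open import Relation.Nullary using (¬_; yes; no)
open import Relation.Binary.PropositionalEquality as ≡ using (_≡_)
import Algebra.Solver.Ring.AlmostCommutativeRing as ACR
import Algebra.Properties.Semiring.Mult.TCOptimised as Mult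
import Algebra.Properties.Ring as RingProperties
import Algebra.Properties.AbelianGroup as AbelianGroupProperties
open import Defs

-- Integer coefficients (rather than coefficients in R) are what lets the
-- solver decide that a coefficient such as 1 - 1 vanishes.
module IntegerCoefficientSolver {c ℓ : Level} (R : CommutativeRing c ℓ) where
  open CommutativeRing R
  open import Relation.Binary.Reasoning.Setoid setoid
  open Mult semiring using (_×_; ×-homo-+; ×1-homo-*)
  open RingProperties ring using (-1*x≈-x)
  open AbelianGroupProperties +-abelianGroup using (⁻¹-∙-comm; ε⁻¹≈ε; ⁻¹-involutive)

  -- n ↦ n · 1.  The optimised multiplication gives 0 · 1 = 0# and 1 · 1 = 1#
  -- definitionally, so the constants 0 and 1 of a solver expression denote
  -- exactly 0# and 1#.
  embed : ℕ → Carrier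
  embed n = n × 1#

  embed-suc : ∀ n → embed (suc n) ≈ 1# + embed n
  embed-suc n = ×-homo-+ 1# 1 n

  ⟦_⟧ : ℤ → Carrier
  ⟦ + n ⟧      = embed n
  ⟦ -[1+ n ] ⟧ = - embed (suc n)

  difference-cancel : ∀ o a b → (o + a) - (o + b) ≈ a - b
  difference-cancel o a b = begin
    (o + a) - (o + b)     ≈⟨ +-congˡ (⁻¹-∙-comm o b) ⟨
    (o + a) + (- o + - b) ≈⟨ +-congˡ (+-comm (- o) (- b)) ⟩
    (o + a) + (- b + - o) ≈⟨ +-assoc o a _ ⟩
    o + (a + (- b + - o)) ≈⟨ +-congˡ (+-assoc a (- b) (- o)) ⟨
    o + ((a - b) + - o)   ≈⟨ +-comm o _ ⟩
    ((a - b) + - o) + o   ≈⟨ +-assoc _ (- o) o ⟩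
    (a - b) + (- o + o)   ≈⟨ +-congˡ (-‿inverseˡ o) ⟩
    (a - b) + 0#          ≈⟨ +-identityʳ _ ⟩
    a - b                 ∎

  ⊖-homo : ∀ m n → ⟦ m ⊖ n ⟧ ≈ embed m - embed n
  ⊖-homo m zero = begin
    ⟦ m ⊖ 0 ⟧    ≡⟨ ≡.cong ⟦_⟧ (ℤP.⊖-≥ {m} {0} z≤n) ⟩
    embed m      ≈⟨ +-identityʳ _ ⟨
    embed m + 0# ≈⟨ +-congˡ ε⁻¹≈ε ⟨
    embed m - 0# ∎
  ⊖-homo zero (suc n) = begin
    ⟦ 0 ⊖ suc n ⟧      ≡⟨ ≡.cong ⟦_⟧ (ℤP.⊖-< {0} {suc n} (s≤s z≤n)) ⟩
    - embed (suc n)    ≈⟨ +-identityˡ _ ⟨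
    0# - embed (suc n) ∎
  ⊖-homo (suc m) (suc n) = begin
    ⟦ suc m ⊖ suc n ⟧               ≡⟨ ≡.cong ⟦_⟧ (ℤP.[1+m]⊖[1+n]≡m⊖n m n) ⟩
    ⟦ m ⊖ n ⟧                       ≈⟨ ⊖-homo m n ⟩
    embed m - embed n               ≈⟨ difference-cancel 1# (embed m) (embed n) ⟨
    (1# + embed m) - (1# + embed n) ≈⟨ +-cong (embed-suc m) (-‿cong (embed-suc n)) ⟨
    embed (suc m) - embed (suc n)   ∎

  +-homo : ∀ i j → ⟦ i ℤ.+ j ⟧ ≈ ⟦ i ⟧ + ⟦ j ⟧
  +-homo -[1+ m ] -[1+ n ] = begin
    - embed (suc (suc (m ℕ.+ n)))  ≡⟨ ≡.cong (λ k → - embed (suc k)) (≡.sym (ℕP.+-suc m n)) ⟩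
    - embed (suc m ℕ.+ suc n)      ≈⟨ -‿cong (×-homo-+ 1# (suc m) (suc n)) ⟩
    - (embed (suc m) + embed (suc n)) ≈⟨ ⁻¹-∙-comm _ _ ⟨
    - embed (suc m) + - embed (suc n) ∎
  +-homo -[1+ m ] (+ n)    = trans (⊖-homo n (suc m)) (+-comm _ _)
  +-homo (+ m)    -[1+ n ] = ⊖-homo m (suc n)
  +-homo (+ m)    (+ n)    = ×-homo-+ 1# m n

  sign⟦_⟧ : Sign → Carrier
  sign⟦ Sign.+ ⟧ = 1#
  sign⟦ Sign.- ⟧ = - 1#

  sign-homo : ∀ s t → sign⟦ s Sign.* t ⟧ ≈ sign⟦ s ⟧ * sign⟦ t ⟧
  sign-homo Sign.+ t      = sym (*-identityˡ _)
  sign-homo Sign.- Sign.+ = sym (*-identityʳ _)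
  sign-homo Sign.- Sign.- = sym (trans (-1*x≈-x _) (⁻¹-involutive _))

  ◃-homo : ∀ s n → ⟦ s ℤ.◃ n ⟧ ≈ sign⟦ s ⟧ * embed n
  ◃-homo s      zero    = sym (zeroʳ _)
  ◃-homo Sign.+ (suc n) = sym (*-identityˡ _)
  ◃-homo Sign.- (suc n) = sym (-1*x≈-x _)

  sign-abs : ∀ i → ⟦ i ⟧ ≈ sign⟦ ℤ.sign i ⟧ * embed ℤ.∣ i ∣
  sign-abs (+ n)    = sym (*-identityˡ _)
  sign-abs -[1+ n ] = sym (-1*x≈-x _)

  *-homo : ∀ i j → ⟦ i ℤ.* j ⟧ ≈ ⟦ i ⟧ * ⟦ j ⟧
  *-homo i j = begin
    ⟦ i ℤ.* j ⟧                                 ≈⟨ ◃-homo (s Sign.* t) (∣ i ∣ ℕ.* ∣ j ∣) ⟩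
    sign⟦ s Sign.* t ⟧ * embed (∣ i ∣ ℕ.* ∣ j ∣)  ≈⟨ *-cong (sign-homo s t) (×1-homo-* ∣ i ∣ ∣ j ∣) ⟩
    (sign⟦ s ⟧ * sign⟦ t ⟧) * (embed ∣ i ∣ * embed ∣ j ∣) ≈⟨ interchange _ _ _ _ ⟩
    (sign⟦ s ⟧ * embed ∣ i ∣) * (sign⟦ t ⟧ * embed ∣ j ∣) ≈⟨ *-cong (sign-abs i) (sign-abs j) ⟨
    ⟦ i ⟧ * ⟦ j ⟧                               ∎
    where
    s = ℤ.sign i
    t = ℤ.sign j
    ∣_∣ = ℤ.∣_∣
    interchange : ∀ a b x y → (a * b) * (x * y) ≈ (a * x) * (b * y)
    interchange a b x y = begin
      (a * b) * (x * y) ≈⟨ *-assoc a b _ ⟩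
      a * (b * (x * y)) ≈⟨ *-congˡ (*-assoc b x y) ⟨
      a * ((b * x) * y) ≈⟨ *-congˡ (*-congʳ (*-comm b x)) ⟩
      a * ((x * b) * y) ≈⟨ *-congˡ (*-assoc x b y) ⟩
      a * (x * (b * y)) ≈⟨ *-assoc a x _ ⟨
      (a * x) * (b * y) ∎

  -‿homo : ∀ i → ⟦ ℤ.- i ⟧ ≈ - ⟦ i ⟧
  -‿homo (+ zero)  = sym ε⁻¹≈ε
  -‿homo (+ suc n) = refl
  -‿homo -[1+ n ]  = sym (⁻¹-involutive _)

  homomorphism : ℤ.+-*-rawRing ACR.-Raw-AlmostCommutative⟶ ACR.fromCommutativeRing R
  homomorphism = record
    { ⟦_⟧ = ⟦_⟧ ; +-homo = +-homo ; *-homo = *-homo ; -‿homo = -‿homo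
    ; 0-homo = refl ; 1-homo = refl }

  _coeff≟_ : ∀ i j → Maybe (⟦ i ⟧ ≈ ⟦ j ⟧)
  i coeff≟ j with i ℤ.≟ j
  ... | yes ≡.refl = just refl
  ... | no _       = nothing

  open import Algebra.Solver.Ring ℤ.+-*-rawRing (ACR.fromCommutativeRing R) homomorphism _coeff≟_ public
    using (solve; _:=_; _:+_; _:*_; :-_; _:-_; con; Polynomial)

triangular-suc : ∀ m → (suc m ℕ.* suc (suc m)) ℕ./ 2 ≡ (m ℕ.* suc m) ℕ./ 2 ℕ.+ suc m
triangular-suc m = begin
  (suc m ℕ.* suc (suc m)) ℕ./ 2               ≡⟨ ≡.cong (ℕ._/ 2) (expand m) ⟩
  (m ℕ.* suc m ℕ.+ suc m ℕ.* 2) ℕ./ 2         ≡⟨ +-distrib-/-∣ʳ (m ℕ.* suc m) (divides-refl (suc m)) ⟩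
  (m ℕ.* suc m) ℕ./ 2 ℕ.+ (suc m ℕ.* 2) ℕ./ 2 ≡⟨ ≡.cong ((m ℕ.* suc m) ℕ./ 2 ℕ.+_) (m*n/n≡m (suc m) 2) ⟩
  (m ℕ.* suc m) ℕ./ 2 ℕ.+ suc m               ∎
  where
  open ≡.≡-Reasoning
  expand : ∀ m → suc m ℕ.* suc (suc m) ≡ m ℕ.* suc m ℕ.+ suc m ℕ.* 2
  expand = solve-∀

module FieldAlgebra {a ℓ : Level} (F : Field a ℓ) where
  open Field F
  open FieldOps F
  open IntegerCoefficientSolver commutativeRing
  open import Relation.Binary.Reasoning.Setoid setoid

  𝟙 : ∀ {n} → Polynomial n
  𝟙 = con (+ 1)

  *-≉0 : ∀ {x y} → x ≉ 0# → y ≉ 0# → x * y ≉ 0#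
  *-≉0 {x} {y} x≉0 y≉0 xy≈0 = x≉0 (begin
    x                ≈⟨ *-identityʳ x ⟨
    x * 1#           ≈⟨ *-congˡ (inverse y y≉0) ⟨
    x * (y * y ⁻¹)   ≈⟨ *-assoc x y (y ⁻¹) ⟨
    (x * y) * y ⁻¹   ≈⟨ *-congʳ xy≈0 ⟩
    0# * y ⁻¹        ≈⟨ zeroˡ _ ⟩
    0#               ∎)

  -- 1 - x vanishes only at x = 1; every denominator below has this shape.
  1-x≉0 : ∀ {x} → ¬ (x ≈ 1#) → 1# - x ≉ 0#
  1-x≉0 {x} x≉1 1-x≈0 = x≉1 (begin
    x             ≈⟨ solve 1 (λ x → x := 𝟙 :- (𝟙 :- x)) refl x ⟩
    1# - (1# - x) ≈⟨ +-congˡ (-‿cong 1-x≈0) ⟩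
    1# - 0#       ≈⟨ solve 0 (𝟙 :- con (+ 0) := 𝟙) refl ⟩
    1#            ∎)

  ⁻¹-unique : ∀ {x y} → x ≉ 0# → x * y ≈ 1# → y ≈ x ⁻¹
  ⁻¹-unique {x} {y} x≉0 xy≈1 = begin
    y              ≈⟨ *-identityʳ y ⟨
    y * 1#         ≈⟨ *-congˡ (inverse x x≉0) ⟨
    y * (x * x ⁻¹) ≈⟨ solve 3 (λ y x i → y :* (x :* i) := (x :* y) :* i) refl y x (x ⁻¹) ⟩
    (x * y) * x ⁻¹ ≈⟨ *-congʳ xy≈1 ⟩
    1# * x ⁻¹      ≈⟨ *-identityˡ _ ⟩
    x ⁻¹           ∎

  ⁻¹-* : ∀ {x y} → x ≉ 0# → y ≉ 0# → (x * y) ⁻¹ ≈ x ⁻¹ * y ⁻¹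
  ⁻¹-* {x} {y} x≉0 y≉0 = sym (⁻¹-unique (*-≉0 x≉0 y≉0) (begin
    (x * y) * (x ⁻¹ * y ⁻¹) ≈⟨ solve 4 (λ x y i j → (x :* y) :* (i :* j) := (x :* i) :* (y :* j)) refl x y (x ⁻¹) (y ⁻¹) ⟩
    (x * x ⁻¹) * (y * y ⁻¹) ≈⟨ *-cong (inverse x x≉0) (inverse y y≉0) ⟩
    1# * 1#                 ≈⟨ *-identityˡ 1# ⟩
    1#                      ∎))

  ÷-cong : ∀ {a b c d} → a ≈ c → b ≈ d → a ÷ b ≈ c ÷ d
  ÷-cong a≈c b≈d = *-cong a≈c (⁻¹-cong b≈d)

  ÷-cancelʳ : ∀ {a b} → b ≉ 0# → (a ÷ b) * b ≈ a
  ÷-cancelʳ {a} {b} b≉0 = begin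
    a * b ⁻¹ * b   ≈⟨ solve 3 (λ a i b → a :* i :* b := a :* (b :* i)) refl a (b ⁻¹) b ⟩
    a * (b * b ⁻¹) ≈⟨ *-congˡ (inverse b b≉0) ⟩
    a * 1#         ≈⟨ *-identityʳ a ⟩
    a              ∎

  ÷-cross : ∀ {a b c d} → b ≉ 0# → d ≉ 0# → a * d ≈ c * b → a ÷ b ≈ c ÷ d
  ÷-cross {a} {b} {c} {d} b≉0 d≉0 ad≈cb = begin
    a * b ⁻¹                ≈⟨ ÷-cancelʳ d≉0 ⟨
    a * b ⁻¹ * d ⁻¹ * d     ≈⟨ solve 4 (λ a i j d → a :* i :* j :* d := (a :* d) :* i :* j) refl a (b ⁻¹) (d ⁻¹) d ⟩
    (a * d) * b ⁻¹ * d ⁻¹   ≈⟨ *-congʳ (*-congʳ ad≈cb) ⟩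
    (c * b) * b ⁻¹ * d ⁻¹   ≈⟨ solve 4 (λ c b i j → (c :* b) :* i :* j := c :* j :* i :* b) refl c b (b ⁻¹) (d ⁻¹) ⟩
    c * d ⁻¹ * b ⁻¹ * b     ≈⟨ ÷-cancelʳ b≉0 ⟩
    c * d ⁻¹                ∎

  ÷-*-÷ : ∀ {a b c d} → b ≉ 0# → d ≉ 0# → (a ÷ b) * (c ÷ d) ≈ (a * c) ÷ (b * d)
  ÷-*-÷ {a} {b} {c} {d} b≉0 d≉0 = begin
    a * b ⁻¹ * (c * d ⁻¹)   ≈⟨ solve 4 (λ a i c j → a :* i :* (c :* j) := (a :* c) :* (i :* j)) refl a (b ⁻¹) c (d ⁻¹) ⟩
    (a * c) * (b ⁻¹ * d ⁻¹) ≈⟨ *-congˡ (⁻¹-* b≉0 d≉0) ⟨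
    (a * c) * (b * d) ⁻¹    ∎

  ÷-*-÷ʳ : ∀ {a b c d} → b ≉ 0# → d ≉ 0# → (a ÷ b) * c ÷ d ≈ (a * c) ÷ (b * d)
  ÷-*-÷ʳ {a} {b} {c} {d} b≉0 d≉0 =
    trans (solve 4 (λ a i c j → a :* i :* c :* j := a :* i :* (c :* j)) refl a (b ⁻¹) c (d ⁻¹)) (÷-*-÷ b≉0 d≉0)

  ÷-+-÷ : ∀ {a b c d} → b ≉ 0# → d ≉ 0# → a ÷ b + c ÷ d ≈ (a * d + c * b) ÷ (b * d)
  ÷-+-÷ {a} {b} {c} {d} b≉0 d≉0 = begin
    a * b ⁻¹ + c * d ⁻¹                           ≈⟨ +-cong (*-identityʳ _) (*-identityʳ _) ⟨
    a * b ⁻¹ * 1# + c * d ⁻¹ * 1#                 ≈⟨ +-cong (*-congˡ (inverse d d≉0)) (*-congˡ (inverse b b≉0)) ⟨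
    a * b ⁻¹ * (d * d ⁻¹) + c * d ⁻¹ * (b * b ⁻¹)
      ≈⟨ solve 6 (λ a i c j b d → a :* i :* (d :* j) :+ c :* j :* (b :* i) := (a :* d :+ c :* b) :* (i :* j)) refl a (b ⁻¹) c (d ⁻¹) b d ⟩
    (a * d + c * b) * (b ⁻¹ * d ⁻¹)               ≈⟨ *-congˡ (⁻¹-* b≉0 d≉0) ⟨
    (a * d + c * b) * (b * d) ⁻¹                  ∎

  *-÷ : ∀ {a c d} → a * (c ÷ d) ≈ (a * c) ÷ d
  *-÷ {a} {c} {d} = solve 3 (λ a c i → a :* (c :* i) := (a :* c) :* i) refl a c (d ⁻¹)

  1-÷-* : ∀ {a c} → c ≉ 0# → (1# - a ÷ c) * c ≈ c - a
  1-÷-* {a} {c} c≉0 = begin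
    (1# - a * c ⁻¹) * c ≈⟨ solve 3 (λ a c i → (𝟙 :- a :* i) :* c := c :- a :* i :* c) refl a c (c ⁻¹) ⟩
    c - a * c ⁻¹ * c    ≈⟨ +-congˡ (-‿cong (÷-cancelʳ c≉0)) ⟩
    c - a               ∎

  ÷-split : ∀ {b c e} → e ≉ 0# → (b - c * e) ÷ e ≈ b ÷ e - c
  ÷-split {b} {c} {e} e≉0 = begin
    (b - c * e) * e ⁻¹        ≈⟨ solve 4 (λ b c e i → (b :- c :* e) :* i := b :* i :- c :* (e :* i)) refl b c e (e ⁻¹) ⟩
    b * e ⁻¹ - c * (e * e ⁻¹) ≈⟨ +-congˡ (-‿cong (*-congˡ (inverse e e≉0))) ⟩
    b * e ⁻¹ - c * 1#         ≈⟨ +-congˡ (-‿cong (*-identityʳ c)) ⟩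
    b ÷ e - c                 ∎

  ÷-split₂ : ∀ {a b c e} → e ≉ 0# → (a * e + b - c * e) ÷ e ≈ a + (b ÷ e - c)
  ÷-split₂ {a} {b} {c} {e} e≉0 = begin
    (a * e + b - c * e) * e ⁻¹      ≈⟨ solve 5 (λ a b c e i → (a :* e :+ b :- c :* e) :* i := (a :- c) :* (e :* i) :+ b :* i) refl a b c e (e ⁻¹) ⟩
    (a - c) * (e * e ⁻¹) + b * e ⁻¹ ≈⟨ +-congʳ (*-congˡ (inverse e e≉0)) ⟩
    (a - c) * 1# + b * e ⁻¹         ≈⟨ solve 4 (λ a b c i → (a :- c) :* 𝟙 :+ b :* i := a :+ (b :* i :- c)) refl a b c (e ⁻¹) ⟩
    a + (b ÷ e - c)                 ∎

  +-move-right : ∀ {s t r} → s + t ≈ r → s ≈ r - t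
  +-move-right {s} {t} s+t≈r = trans (solve 2 (λ s t → s := s :+ t :- t) refl s t) (+-congʳ s+t≈r)

  -‿÷ : ∀ {a b} → - (a ÷ b) ≈ (- a) ÷ b
  -‿÷ {a} {b} = solve 2 (λ a i → :- (a :* i) := (:- a) :* i) refl a (b ⁻¹)

  pow-+ : ∀ x m n → pow x (m ℕ.+ n) ≈ pow x m * pow x n
  pow-+ x zero    n = sym (*-identityˡ _)
  pow-+ x (suc m) n = begin
    pow x (m ℕ.+ n) * x   ≈⟨ *-congʳ (pow-+ x m n) ⟩
    pow x m * pow x n * x ≈⟨ solve 3 (λ a b x → a :* b :* x := a :* x :* b) refl (pow x m) (pow x n) x ⟩
    pow x m * x * pow x n ∎

  pow-* : ∀ x y n → pow (x * y) n ≈ pow x n * pow y n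
  pow-* x y zero    = sym (*-identityˡ _)
  pow-* x y (suc n) = begin
    pow (x * y) n * (x * y)     ≈⟨ *-congʳ (pow-* x y n) ⟩
    pow x n * pow y n * (x * y) ≈⟨ solve 4 (λ a b x y → a :* b :* (x :* y) := a :* x :* (b :* y)) refl (pow x n) (pow y n) x y ⟩
    pow x n * x * (pow y n * y) ∎

  pow-tri-suc : ∀ q m → pow q (tri (suc m)) ≈ pow q (tri m) * pow q (suc m)
  pow-tri-suc q m = trans (reflexive (≡.cong (pow q) (triangular-suc m))) (pow-+ q (tri m) (suc m))

  poch-cong : ∀ q {x y} n → x ≈ y → poch q x n ≈ poch q y n
  poch-cong q zero    x≈y = refl
  poch-cong q (suc n) x≈y = *-cong (poch-cong q n x≈y) (+-congˡ (-‿cong (*-congʳ x≈y)))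

  poch-suc : ∀ q x n → poch q x (suc n) ≈ (1# - x) * poch q (x * q) n
  poch-suc q x zero    = solve 1 (λ x → 𝟙 :* (𝟙 :- x :* 𝟙) := (𝟙 :- x) :* 𝟙) refl x
  poch-suc q x (suc n) = begin
    poch q x (suc n) * (1# - x * (pow q n * q))       ≈⟨ *-congʳ (poch-suc q x n) ⟩
    (1# - x) * poch q (x * q) n * (1# - x * (pow q n * q))
      ≈⟨ solve 4 (λ x P t q → (𝟙 :- x) :* P :* (𝟙 :- x :* (t :* q)) := (𝟙 :- x) :* (P :* (𝟙 :- x :* q :* t))) refl x (poch q (x * q) n) (pow q n) q ⟩
    (1# - x) * (poch q (x * q) n * (1# - x * q * pow q n)) ∎

  poch-≉0 : ∀ q x n → (∀ i → i ℕ.< n → ¬ (x * pow q i ≈ 1#)) → poch q x n ≉ 0#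
  poch-≉0 q x zero    x≉q⁻ⁱ 1≈0 = 0≉1 (sym 1≈0)
  poch-≉0 q x (suc n) x≉q⁻ⁱ =
    *-≉0 (poch-≉0 q x n (λ i i<n → x≉q⁻ⁱ i (ℕP.m<n⇒m<1+n i<n))) (1-x≉0 (x≉q⁻ⁱ n ℕP.≤-refl))

  sum1-cong : ∀ N {f g} → (∀ n → 1 ≤ n → n ≤ N → f n ≈ g n) → sum1 N f ≈ sum1 N g
  sum1-cong zero    f≈g = refl
  sum1-cong (suc N) f≈g =
    +-cong (sum1-cong N (λ n 1≤n n≤N → f≈g n 1≤n (ℕP.m≤n⇒m≤1+n n≤N))) (f≈g (suc N) (s≤s z≤n) ℕP.≤-refl)

  sum1-first : ∀ M f → sum1 (suc M) f ≈ f 1 + sum1 M (λ m → f (suc m))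
  sum1-first zero    f = trans (+-identityˡ _) (sym (+-identityʳ _))
  sum1-first (suc M) f = begin
    sum1 (suc M) f + f (suc (suc M))                 ≈⟨ +-congʳ (sum1-first M f) ⟩
    f 1 + sum1 M (λ m → f (suc m)) + f (suc (suc M)) ≈⟨ +-assoc _ _ _ ⟩
    f 1 + (sum1 M (λ m → f (suc m)) + f (suc (suc M))) ∎

  sum1-scale : ∀ M k f → sum1 M (λ m → k * f m) ≈ k * sum1 M f
  sum1-scale zero    k f = sym (zeroʳ k)
  sum1-scale (suc M) k f = trans (+-congʳ (sum1-scale M k f)) (sym (distribˡ k _ _))

module QIdentity {a ℓ : Level} (F : Field a ℓ) (q : Field.Carrier F) where
  open Field F
  open FieldOps F
  open FieldAlgebra F
  open IntegerCoefficientSolver commutativeRing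
  open RingProperties ring using (-‿distribˡ-*)
  open import Relation.Binary.Reasoning.Setoid setoid

  NoRootOfUnity : ℕ → Set ℓ
  NoRootOfUnity N = ∀ j → 1 ≤ j → j ≤ N → ¬ (pow q j ≈ 1#)

  Avoids : ℕ → Carrier → Set ℓ
  Avoids N x = ∀ n → 1 ≤ n → n ≤ N → ¬ (x * pow q n ≈ 1#)

  NoRootOfUnity-weaken : ∀ {M} → NoRootOfUnity (suc M) → NoRootOfUnity M
  NoRootOfUnity-weaken hq j 1≤j j≤M = hq j 1≤j (ℕP.m≤n⇒m≤1+n j≤M)

  Avoids-weaken : ∀ {M x} → Avoids (suc M) x → Avoids M x
  Avoids-weaken hx n 1≤n n≤M = hx n 1≤n (ℕP.m≤n⇒m≤1+n n≤M)

  -- (xq) q^n = x q^{n+1}: shifting the parameter uses up one condition.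
  Avoids-shift : ∀ {M x} → Avoids (suc M) x → Avoids M (x * q)
  Avoids-shift {x = x} hx n 1≤n n≤M xq·qⁿ≈1 =
    hx (suc n) (s≤s z≤n) (s≤s n≤M)
       (trans (solve 3 (λ x q t → x :* (t :* q) := x :* q :* t) refl x q (pow q n)) xq·qⁿ≈1)

  factor-≉0 : ∀ {N x} n → 1 ≤ n → n ≤ N → Avoids N x → 1# - x * pow q n ≉ 0#
  factor-≉0 n 1≤n n≤N hx = 1-x≉0 (hx n 1≤n n≤N)

  first-factor-≉0 : ∀ {M x} → Avoids (suc M) x → 1# - x * q ≉ 0#
  first-factor-≉0 {x = x} hx = 1-x≉0 (λ xq≈1 →
    hx 1 (s≤s z≤n) (s≤s z≤n) (trans (solve 2 (λ x q → x :* (𝟙 :* q) := x :* q) refl x q) xq≈1))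

  poch-q-≉0 : ∀ {N} n → n ≤ N → NoRootOfUnity N → poch q q n ≉ 0#
  poch-q-≉0 n n≤N hq = poch-≉0 q q n (λ i i<n qqⁱ≈1 →
    hq (suc i) (s≤s z≤n) (ℕP.≤-trans i<n n≤N) (trans (*-comm (pow q i) q) qqⁱ≈1))

  poch-shifted-≉0 : ∀ {N} n x → n ≤ N → Avoids N x → poch q (x * q) n ≉ 0#
  poch-shifted-≉0 n x n≤N hx = poch-≉0 q (x * q) n (λ i i<n xq·qⁱ≈1 →
    hx (suc i) (s≤s z≤n) (ℕP.≤-trans i<n n≤N)
       (trans (solve 3 (λ x q t → x :* (t :* q) := x :* q :* t) refl x q (pow q i)) xq·qⁱ≈1))

  leftTerm : ℕ → Carrier → Carrier → ℕ → Carrier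
  leftTerm N z c n =
    qbinom q N n * (pow (- 1#) (n ∸ 1) * pow z n * pow q (tri n) * poch q q n)
      ÷ ((1# - c * pow q n) * poch q (z * q) n)

  -- K_M(z) = zq (1 - q^{M+1}) / (1 - zq), the ratio linking leftTerm at
  -- (M+1, z, c) to leftTerm at (M, zq, cq).
  leftRatio : ℕ → Carrier → Carrier
  leftRatio M z = (z * q * (1# - pow q (suc M))) ÷ (1# - z * q)

  ℒ : ℕ → Carrier → Carrier → Carrier
  ℒ zero    z c = 0#
  ℒ (suc M) z c = leftRatio M z * (1# ÷ (1# - c * q) - ℒ M (z * q) (c * q))

  leftTerm-first : ∀ M z c → NoRootOfUnity (suc M) → Avoids (suc M) z → Avoids (suc M) c →
    leftTerm (suc M) z c 1 ≈ leftRatio M z * (1# ÷ (1# - c * q))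
  leftTerm-first M z c hq hz hc = begin
    leftTerm (suc M) z c 1 ≈⟨ ÷-*-÷ʳ num≉0 den≉0 ⟩
    _                      ≈⟨ ÷-cross (*-≉0 num≉0 den≉0) (*-≉0 (first-factor-≉0 hz) (first-factor-≉0 hc))
                                (solve 5 (λ P t z c q →
                                  (P :* (𝟙 :- q :* t) :* (𝟙 :* (𝟙 :* z) :* (𝟙 :* q) :* (𝟙 :* (𝟙 :- q :* 𝟙)))) :* ((𝟙 :- z :* q) :* (𝟙 :- c :* q))
                                  := (z :* q :* (𝟙 :- t :* q) :* 𝟙) :* ((𝟙 :* (𝟙 :- q :* 𝟙) :* P) :* ((𝟙 :- c :* (𝟙 :* q)) :* (𝟙 :* (𝟙 :- z :* q :* 𝟙)))))
                                 refl (poch q q M) (pow q M) z c q) ⟩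
    _                      ≈⟨ ÷-*-÷ (first-factor-≉0 hz) (first-factor-≉0 hc) ⟨
    leftRatio M z * (1# ÷ (1# - c * q)) ∎
    where
    num≉0 = *-≉0 (poch-q-≉0 1 (s≤s z≤n) hq) (poch-q-≉0 M (ℕP.n≤1+n M) hq)
    den≉0 = *-≉0 (factor-≉0 1 (s≤s z≤n) (s≤s z≤n) hc) (poch-shifted-≉0 1 z (s≤s z≤n) hz)

  -- For 2 ≤ n ≤ M+1 the n-th term at (M+1, z, c) is -K_M(z) times the
  -- (n-1)-th term at (M, zq, cq): the q-binomial, (q)_n, z^n q^{tri n} and
  -- (zq)_n each lose their first or last factor.
  leftTerm-step : ∀ M z c m' → suc m' ≤ M → NoRootOfUnity (suc M) → Avoids (suc M) z → Avoids (suc M) c →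
    leftTerm (suc M) z c (suc (suc m')) ≈ (- leftRatio M z) * leftTerm M (z * q) (c * q) (suc m')
  leftTerm-step M z c m' m≤M hq hz hc = begin
    leftTerm (suc M) z c (suc m)
      ≈⟨ ÷-cong (*-congˡ (*-congʳ (*-congˡ (pow-tri-suc q m)))) (*-congˡ (poch-suc q (z * q) m)) ⟩
    _ ≈⟨ ÷-*-÷ʳ num≉0 den≉0 ⟩
    _ ≈⟨ ÷-cross (*-≉0 num≉0 den≉0) (*-≉0 zq≉1 (*-≉0 num'≉0 den'≉0))
           (solve 12 (λ P t R w B s y T Z z c q →
             (P :* (𝟙 :- q :* t) :* (s :* (:- 𝟙) :* (y :* z) :* (T :* (w :* q)) :* (R :* (𝟙 :- q :* w)))) :* ((𝟙 :- z :* q) :* ((R :* B) :* ((𝟙 :- c :* q :* w) :* Z)))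
             := (:- (z :* q :* (𝟙 :- t :* q) :* (P :* (s :* (y :* w) :* T :* R)))) :* (((R :* (𝟙 :- q :* w)) :* B) :* ((𝟙 :- c :* (w :* q)) :* ((𝟙 :- z :* q) :* Z))))
            refl (poch q q M) (pow q M) (poch q q m) (pow q m) (poch q q (M ∸ m)) (pow (- 1#) m') (pow z m)
                 (pow q (tri m)) (poch q (z * q * q) m) z c q) ⟩
    _ ≈⟨ -‿÷ ⟨
    _ ≈⟨ -‿cong (÷-*-÷ zq≉1 (*-≉0 num'≉0 den'≉0)) ⟨
    _ ≈⟨ -‿cong (*-congˡ (÷-*-÷ʳ num'≉0 den'≉0)) ⟨
    _ ≈⟨ -‿cong (*-congˡ (÷-cong (*-congˡ (*-congʳ (*-congʳ (*-congˡ (pow-* z q m))))) refl)) ⟨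
    - (leftRatio M z * leftTerm M (z * q) (c * q) m) ≈⟨ -‿distribˡ-* _ _ ⟩
    (- leftRatio M z) * leftTerm M (z * q) (c * q) m ∎
    where
    m = suc m'
    zq≉1 = first-factor-≉0 hz
    M-m≉0 = poch-q-≉0 (M ∸ m) (ℕP.≤-trans (ℕP.m∸n≤m M m) (ℕP.n≤1+n M)) hq
    num≉0 = *-≉0 (poch-q-≉0 (suc m) (s≤s m≤M) hq) M-m≉0
    num'≉0 = *-≉0 (poch-q-≉0 m (ℕP.m≤n⇒m≤1+n m≤M) hq) M-m≉0
    zq·m≉0 = poch-shifted-≉0 m (z * q) m≤M (Avoids-shift hz)
    den≉0 = *-≉0 (factor-≉0 (suc m) (s≤s z≤n) (s≤s m≤M) hc) (*-≉0 zq≉1 zq·m≉0)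
    den'≉0 = *-≉0 (factor-≉0 m (s≤s z≤n) m≤M (Avoids-shift hc)) zq·m≉0

  leftSum≈ℒ : ∀ N z c → NoRootOfUnity N → Avoids N z → Avoids N c → sum1 N (leftTerm N z c) ≈ ℒ N z c
  leftSum≈ℒ zero    z c hq hz hc = refl
  leftSum≈ℒ (suc M) z c hq hz hc = begin
    sum1 (suc M) (leftTerm (suc M) z c) ≈⟨ sum1-first M _ ⟩
    leftTerm (suc M) z c 1 + sum1 M (λ m → leftTerm (suc M) z c (suc m))
      ≈⟨ +-cong (leftTerm-first M z c hq hz hc)
                (sum1-cong M λ { (suc m') _ m≤M → leftTerm-step M z c m' m≤M hq hz hc }) ⟩
    K * (1# ÷ e) + sum1 M (λ m → (- K) * leftTerm M (z * q) (c * q) m)  ≈⟨ +-congˡ (sum1-scale M (- K) _) ⟩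
    K * (1# ÷ e) + (- K) * sum1 M (leftTerm M (z * q) (c * q))
      ≈⟨ +-congˡ (*-congˡ (leftSum≈ℒ M (z * q) (c * q) (NoRootOfUnity-weaken hq) (Avoids-shift hz) (Avoids-shift hc))) ⟩
    K * (1# ÷ e) + (- K) * ℒ M (z * q) (c * q)
      ≈⟨ solve 3 (λ k a b → k :* a :+ (:- k) :* b := k :* (a :- b)) refl K (1# ÷ e) (ℒ M (z * q) (c * q)) ⟩
    ℒ (suc M) z c ∎
    where
    K = leftRatio M z
    e = 1# - c * q

  -- The n-th summand of the right-hand side at (N, z, c), without the
  -- prefactor z/c.
  rightTerm : ℕ → Carrier → Carrier → ℕ → Carrier
  rightTerm N z c n =
    qbinom q N n * (poch q (z * q ÷ c) (n ∸ 1) * poch q q n * poch q (c * q) (N ∸ n) * pow (c * q) n)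
      ÷ (poch q (z * q) n * poch q (c * q) N)

  rightRatio : ℕ → Carrier → Carrier → Carrier
  rightRatio M z c = (1# - pow q (suc M)) ÷ ((1# - c * pow q (suc M)) * (1# - z * q))

  ℛ : ℕ → Carrier → Carrier → Carrier
  ℛ zero    z c = 0#
  ℛ (suc M) z c = rightRatio M z c * (z * q + (c - z * q) * ℛ M (z * q) c)

  rightTerm-first : ∀ M z c → NoRootOfUnity (suc M) → Avoids (suc M) z → Avoids (suc M) c →
    rightTerm (suc M) z c 1 ≈ c * q * rightRatio M z c
  rightTerm-first M z c hq hz hc = begin
    rightTerm (suc M) z c 1 ≈⟨ ÷-*-÷ʳ num≉0 den≉0 ⟩
    _                       ≈⟨ ÷-cross (*-≉0 num≉0 den≉0) ratio-den≉0
                                 (solve 6 (λ P t C z c q →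
                                   (P :* (𝟙 :- q :* t) :* (𝟙 :* (𝟙 :* (𝟙 :- q :* 𝟙)) :* C :* (𝟙 :* (c :* q)))) :* ((𝟙 :- c :* (t :* q)) :* (𝟙 :- z :* q))
                                   := (c :* q :* (𝟙 :- t :* q)) :* ((𝟙 :* (𝟙 :- q :* 𝟙) :* P) :* ((𝟙 :* (𝟙 :- z :* q :* 𝟙)) :* (C :* (𝟙 :- c :* q :* t)))))
                                  refl (poch q q M) (pow q M) (poch q (c * q) M) z c q) ⟩
    _                       ≈⟨ *-÷ ⟨
    c * q * rightRatio M z c ∎
    where
    num≉0 = *-≉0 (poch-q-≉0 1 (s≤s z≤n) hq) (poch-q-≉0 M (ℕP.n≤1+n M) hq)
    den≉0 = *-≉0 (poch-shifted-≉0 1 z (s≤s z≤n) hz) (poch-shifted-≉0 (suc M) c ℕP.≤-refl hc)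
    ratio-den≉0 = *-≉0 (factor-≉0 (suc M) (s≤s z≤n) ℕP.≤-refl hc) (first-factor-≉0 hz)

  -- For 2 ≤ n ≤ M+1 the n-th term at (M+1, z, c) is α_M(z, c)(c - zq)q times
  -- the (n-1)-th term at (M, zq, c); here c ≠ 0 is needed, since
  -- (zq/c; q)_{n-1} = (1 - zq/c)(zq²/c; q)_{n-2} and c(1 - zq/c) = c - zq.
  rightTerm-step : ∀ M z c m' → suc m' ≤ M → c ≉ 0# →
    NoRootOfUnity (suc M) → Avoids (suc M) z → Avoids (suc M) c →
    rightTerm (suc M) z c (suc (suc m')) ≈ (rightRatio M z c * ((c - z * q) * q)) * rightTerm M (z * q) c (suc m')
  rightTerm-step M z c m' m≤M c≉0 hq hz hc = begin
    rightTerm (suc M) z c (suc m)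
      ≈⟨ ÷-cong (*-congˡ (*-congʳ (*-congʳ (*-congʳ first-factor)))) (*-congʳ (poch-suc q (z * q) m)) ⟩
    _ ≈⟨ ÷-*-÷ʳ num≉0 den≉0 ⟩
    _ ≈⟨ ÷-cross (*-≉0 num≉0 den≉0) (*-≉0 ratio-den≉0 (*-≉0 num'≉0 den'≉0)) cross-multiplied ⟩
    _ ≈⟨ ÷-*-÷ ratio-den≉0 (*-≉0 num'≉0 den'≉0) ⟨
    _ ≈⟨ *-cong (reorder (1# - pow q (suc M)) _ ((c - z * q) * q)) (÷-*-÷ʳ num'≉0 den'≉0) ⟨
    (rightRatio M z c * ((c - z * q) * q)) * rightTerm M (z * q) c m ∎
    where
    m = suc m'
    reorder : ∀ u i k → u * i * k ≈ u * k * i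
    reorder u i k = solve 3 (λ u i k → u :* i :* k := u :* k :* i) refl u i k
    first-factor : poch q (z * q ÷ c) (suc m') ≈ (1# - z * q ÷ c) * poch q (z * q * q ÷ c) m'
    first-factor = trans (poch-suc q (z * q ÷ c) m')
      (*-congˡ (poch-cong q m' (solve 3 (λ z q i → z :* q :* i :* q := z :* q :* q :* i) refl z q (c ⁻¹))))
    zq≉1 = first-factor-≉0 hz
    M-m≉0 = poch-q-≉0 (M ∸ m) (ℕP.≤-trans (ℕP.m∸n≤m M m) (ℕP.n≤1+n M)) hq
    num≉0 = *-≉0 (poch-q-≉0 (suc m) (s≤s m≤M) hq) M-m≉0
    num'≉0 = *-≉0 (poch-q-≉0 m (ℕP.m≤n⇒m≤1+n m≤M) hq) M-m≉0
    zq·m≉0 = poch-shifted-≉0 m (z * q) m≤M (Avoids-shift hz)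
    den≉0 = *-≉0 (*-≉0 zq≉1 zq·m≉0) (poch-shifted-≉0 (suc M) c ℕP.≤-refl hc)
    den'≉0 = *-≉0 zq·m≉0 (poch-shifted-≉0 M c (ℕP.n≤1+n M) hc)
    ratio-den≉0 = *-≉0 (factor-≉0 (suc M) (s≤s z≤n) ℕP.≤-refl hc) zq≉1
    P = poch q q M
    t = pow q M
    Pm = poch q q m
    w = pow q m
    B = poch q q (M ∸ m)
    A = poch q (z * q * q ÷ c) m'
    G = poch q (c * q) (M ∸ m)
    pw = pow (c * q) m
    Z = poch q (z * q * q) m
    C = poch q (c * q) M
    E = P * (1# - q * t) * A * (Pm * (1# - q * w)) * G * pw * q * (1# - c * (t * q)) * (1# - z * q) * Pm * B * Z * C
    cross-multiplied :
      (P * (1# - q * t) * ((1# - z * q ÷ c) * A * (Pm * (1# - q * w)) * G * (pw * (c * q))))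
        * ((1# - c * (t * q)) * (1# - z * q) * ((Pm * B) * (Z * C)))
      ≈ ((1# - pow q (suc M)) * ((c - z * q) * q)) * (P * (A * Pm * G * pw))
        * ((Pm * (1# - q * w)) * B * ((1# - z * q) * Z * (C * (1# - c * q * t))))
    cross-multiplied = begin
      (P * (1# - q * t) * ((1# - z * q ÷ c) * A * (Pm * (1# - q * w)) * G * (pw * (c * q))))
        * ((1# - c * (t * q)) * (1# - z * q) * ((Pm * B) * (Z * C)))
        ≈⟨ solve 14 (λ P t R w B A G pw Z C z c q i →
             (P :* (𝟙 :- q :* t) :* ((𝟙 :- z :* q :* i) :* A :* (R :* (𝟙 :- q :* w)) :* G :* (pw :* (c :* q))))
               :* ((𝟙 :- c :* (t :* q)) :* (𝟙 :- z :* q) :* ((R :* B) :* (Z :* C)))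
             := (P :* (𝟙 :- q :* t) :* A :* (R :* (𝟙 :- q :* w)) :* G :* pw :* q :* (𝟙 :- c :* (t :* q)) :* (𝟙 :- z :* q) :* R :* B :* Z :* C)
               :* ((𝟙 :- z :* q :* i) :* c))
            refl P t Pm w B A G pw Z C z c q (c ⁻¹) ⟩
      E * ((1# - z * q ÷ c) * c) ≈⟨ *-congˡ (1-÷-* c≉0) ⟩
      E * (c - z * q)
        ≈⟨ solve 13 (λ P t R w B A G pw Z C z c q →
             (P :* (𝟙 :- q :* t) :* A :* (R :* (𝟙 :- q :* w)) :* G :* pw :* q :* (𝟙 :- c :* (t :* q)) :* (𝟙 :- z :* q) :* R :* B :* Z :* C) :* (c :- z :* q)
             := ((𝟙 :- t :* q) :* ((c :- z :* q) :* q)) :* (P :* (A :* R :* G :* pw))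
               :* ((R :* (𝟙 :- q :* w)) :* B :* ((𝟙 :- z :* q) :* Z :* (C :* (𝟙 :- c :* q :* t)))))
            refl P t Pm w B A G pw Z C z c q ⟩
      ((1# - pow q (suc M)) * ((c - z * q) * q)) * (P * (A * Pm * G * pw))
        * ((Pm * (1# - q * w)) * B * ((1# - z * q) * Z * (C * (1# - c * q * t)))) ∎

  rightSum≈ℛ : ∀ N z c → c ≉ 0# → NoRootOfUnity N → Avoids N z → Avoids N c →
    (z ÷ c) * sum1 N (rightTerm N z c) ≈ ℛ N z c
  rightSum≈ℛ zero    z c c≉0 hq hz hc = zeroʳ _
  rightSum≈ℛ (suc M) z c c≉0 hq hz hc = begin
    (z ÷ c) * sum1 (suc M) (rightTerm (suc M) z c) ≈⟨ *-congˡ (sum1-first M _) ⟩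
    (z ÷ c) * (rightTerm (suc M) z c 1 + sum1 M (λ m → rightTerm (suc M) z c (suc m)))
      ≈⟨ *-congˡ (+-cong (rightTerm-first M z c hq hz hc)
                         (sum1-cong M λ { (suc m') _ m≤M → rightTerm-step M z c m' m≤M c≉0 hq hz hc })) ⟩
    (z ÷ c) * (c * q * α + sum1 M (λ m → k * rightTerm M (z * q) c m)) ≈⟨ *-congˡ (+-congˡ (sum1-scale M k _)) ⟩
    (z ÷ c) * (c * q * α + k * S)
      ≈⟨ solve 6 (λ z c i q α S → z :* i :* (c :* q :* α :+ α :* ((c :- z :* q) :* q) :* S)
                    := α :* z :* q :* (c :* i) :+ α :* ((c :- z :* q) :* (z :* q :* i :* S))) refl z c (c ⁻¹) q α S ⟩
    α * z * q * (c * c ⁻¹) + α * ((c - z * q) * ((z * q ÷ c) * S)) ≈⟨ +-congʳ (*-congˡ (inverse c c≉0)) ⟩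
    α * z * q * 1# + α * ((c - z * q) * ((z * q ÷ c) * S))
      ≈⟨ solve 4 (λ α z q X → α :* z :* q :* 𝟙 :+ α :* X := α :* (z :* q :+ X)) refl α z q ((c - z * q) * ((z * q ÷ c) * S)) ⟩
    α * (z * q + (c - z * q) * ((z * q ÷ c) * S))
      ≈⟨ *-congˡ (+-congˡ (*-congˡ
           (rightSum≈ℛ M (z * q) c c≉0 (NoRootOfUnity-weaken hq) (Avoids-shift hz) (Avoids-weaken hc)))) ⟩
    ℛ (suc M) z c ∎
    where
    α = rightRatio M z c
    k = α * ((c - z * q) * q)
    S = sum1 M (rightTerm M (z * q) c)

  -- A contiguous relation for ℛ, linking c and cq:
  --   (c - z) ℛ_M(z, c) + z(1 - cq^{M+1}) ℛ_M(z, cq) = zcq(1 - q^M)/(1 - cq).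
  -- It is what turns the right-hand recursion (c fixed) into the left-hand
  -- one (c ↦ cq).
  ℛ-contiguous : ∀ M z c → Avoids M z → Avoids (suc M) c →
    (c - z) * ℛ M z c + z * (1# - c * pow q (suc M)) * ℛ M z (c * q)
      ≈ (z * c * q * (1# - pow q M)) ÷ (1# - c * q)
  ℛ-contiguous zero z c hz hc =
    solve 5 (λ z c q i w → (c :- z) :* con (+ 0) :+ w :* con (+ 0) := z :* c :* q :* (𝟙 :- 𝟙) :* i)
      refl z c q ((1# - c * q) ⁻¹) (z * (1# - c * pow q 1))
  ℛ-contiguous (suc M) z c hz hc = begin
    (c - z) * ℛ (suc M) z c + z * (1# - c * pow q (suc (suc M))) * ℛ (suc M) z (c * q)
      ≈⟨ +-cong (into-fraction (c - z) _ _ _) (into-fraction _ _ _ _) ⟩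
    ((c - z) * (u * P₁)) ÷ D₁ + (z * (1# - c * pow q (suc (suc M))) * (u * P₂)) ÷ D₂
      ≈⟨ ÷-+-÷ D₁≉0 D₂≉0 ⟩
    ((c - z) * (u * P₁) * D₂ + z * (1# - c * pow q (suc (suc M))) * (u * P₂) * D₁) ÷ (D₁ * D₂)
      ≈⟨ ÷-cross (*-≉0 D₁≉0 D₂≉0) cq≉1 cross-multiplied ⟩
    (z * c * q * (1# - pow q (suc M))) ÷ (1# - c * q) ∎
    where
    into-fraction : ∀ x a b p → x * ((a ÷ b) * p) ≈ (x * (a * p)) ÷ b
    into-fraction x a b p = solve 4 (λ x a i p → x :* ((a :* i) :* p) := (x :* (a :* p)) :* i) refl x a (b ⁻¹) p
    X = ℛ M (z * q) c
    Y = ℛ M (z * q) (c * q)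
    u = 1# - pow q (suc M)
    P₁ = z * q + (c - z * q) * X
    P₂ = z * q + (c * q - z * q) * Y
    D₁ = (1# - c * pow q (suc M)) * (1# - z * q)
    D₂ = (1# - c * q * pow q (suc M)) * (1# - z * q)
    zq≉1 = first-factor-≉0 hz
    cq≉1 = first-factor-≉0 hc
    D₁≉0 = *-≉0 (factor-≉0 (suc M) (s≤s z≤n) (ℕP.n≤1+n (suc M)) hc) zq≉1
    D₂≉0 = *-≉0 (factor-≉0 (suc M) (s≤s z≤n) ℕP.≤-refl (Avoids-shift hc)) zq≉1
    e = 1# - c * q
    V = z * q * c * q * (1# - pow q M)
    G = (c - z * q) * X + z * q * (1# - c * pow q (suc M)) * Y
    IH : G * e ≈ V
    IH = trans (*-congʳ (ℛ-contiguous M (z * q) c (Avoids-shift hz) (Avoids-weaken hc))) (÷-cancelʳ cq≉1)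
    cross-multiplied :
      ((c - z) * (u * P₁) * D₂ + z * (1# - c * pow q (suc (suc M))) * (u * P₂) * D₁) * e
        ≈ (z * c * q * (1# - pow q (suc M))) * (D₁ * D₂)
    cross-multiplied = begin
      ((c - z) * (u * P₁) * D₂ + z * (1# - c * pow q (suc (suc M))) * (u * P₂) * D₁) * e
        ≈⟨ solve 6 (λ z c q t X Y →
             ((c :- z) :* ((𝟙 :- t :* q) :* (z :* q :+ (c :- z :* q) :* X)) :* ((𝟙 :- c :* q :* (t :* q)) :* (𝟙 :- z :* q))
              :+ z :* (𝟙 :- c :* (t :* q :* q)) :* ((𝟙 :- t :* q) :* (z :* q :+ (c :* q :- z :* q) :* Y)) :* ((𝟙 :- c :* (t :* q)) :* (𝟙 :- z :* q))) :* (𝟙 :- c :* q)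
             := (𝟙 :- t :* q) :* (𝟙 :- z :* q) :* (𝟙 :- c :* q :* (t :* q))
                  :* (((c :- z) :* (z :* q) :+ z :* (𝟙 :- c :* (t :* q)) :* (z :* q)) :* (𝟙 :- c :* q)
                      :+ (c :- z) :* (((c :- z :* q) :* X :+ z :* q :* (𝟙 :- c :* (t :* q)) :* Y) :* (𝟙 :- c :* q))))
             refl z c q (pow q M) X Y ⟩
      u * (1# - z * q) * (1# - c * q * pow q (suc M)) * (((c - z) * (z * q) + z * (1# - c * pow q (suc M)) * (z * q)) * e + (c - z) * (G * e))
        ≈⟨ *-congˡ (+-congˡ (*-congˡ IH)) ⟩
      u * (1# - z * q) * (1# - c * q * pow q (suc M)) * (((c - z) * (z * q) + z * (1# - c * pow q (suc M)) * (z * q)) * e + (c - z) * V)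
        ≈⟨ solve 4 (λ z c q t →
             (𝟙 :- t :* q) :* (𝟙 :- z :* q) :* (𝟙 :- c :* q :* (t :* q))
               :* (((c :- z) :* (z :* q) :+ z :* (𝟙 :- c :* (t :* q)) :* (z :* q)) :* (𝟙 :- c :* q) :+ (c :- z) :* (z :* q :* c :* q :* (𝟙 :- t)))
             := z :* c :* q :* (𝟙 :- t :* q) :* (((𝟙 :- c :* (t :* q)) :* (𝟙 :- z :* q)) :* ((𝟙 :- c :* q :* (t :* q)) :* (𝟙 :- z :* q))))
             refl z c q (pow q M) ⟩
      (z * c * q * (1# - pow q (suc M))) * (D₁ * D₂) ∎

  ℒ≈ℛ : ∀ N z c → Avoids N z → Avoids N c → ℒ N z c ≈ ℛ N z c
  ℒ≈ℛ zero    z c hz hc = refl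
  ℒ≈ℛ (suc M) z c hz hc = begin
    K * (1# ÷ e - ℒ M (z * q) (c * q))
      ≈⟨ *-congˡ (+-congˡ (-‿cong (ℒ≈ℛ M (z * q) (c * q) (Avoids-shift hz) (Avoids-shift hc)))) ⟩
    K * (1# ÷ e - Y)                                   ≈⟨ *-congˡ (÷-split e≉0) ⟨
    K * ((1# - Y * e) ÷ e)                             ≈⟨ ÷-*-÷ zq≉1 e≉0 ⟩
    (z * q * u * (1# - Y * e)) ÷ ((1# - z * q) * e)    ≈⟨ ÷-cross (*-≉0 zq≉1 e≉0) (*-≉0 D≉0 e≉0) cross-multiplied ⟩
    (u * (z * q * e + W - z * q * d * Y * e)) ÷ (D * e) ≈⟨ ÷-*-÷ D≉0 e≉0 ⟨
    (u ÷ D) * ((z * q * e + W - z * q * d * Y * e) ÷ e) ≈⟨ *-congˡ (÷-split₂ e≉0) ⟩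
    (u ÷ D) * (z * q + (W ÷ e - z * q * d * Y))         ≈⟨ *-congˡ (+-congˡ (+-move-right contiguity)) ⟨
    ℛ (suc M) z c ∎
    where
    u = 1# - pow q (suc M)
    e = 1# - c * q
    K = leftRatio M z
    X = ℛ M (z * q) c
    Y = ℛ M (z * q) (c * q)
    d = 1# - c * pow q (suc M)
    D = d * (1# - z * q)
    W = z * q * c * q * (1# - pow q M)
    zq≉1 = first-factor-≉0 hz
    e≉0 = first-factor-≉0 hc
    D≉0 = *-≉0 (factor-≉0 (suc M) (s≤s z≤n) ℕP.≤-refl hc) zq≉1
    contiguity : (c - z * q) * X + z * q * d * Y ≈ W ÷ e
    contiguity = ℛ-contiguous M (z * q) c (Avoids-shift hz) hc
    cross-multiplied : z * q * u * (1# - Y * e) * (D * e) ≈ u * (z * q * e + W - z * q * d * Y * e) * ((1# - z * q) * e)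
    cross-multiplied = solve 5 (λ z c q t Y →
      z :* q :* (𝟙 :- t :* q) :* (𝟙 :- Y :* (𝟙 :- c :* q)) :* ((𝟙 :- c :* (t :* q)) :* (𝟙 :- z :* q) :* (𝟙 :- c :* q))
      := (𝟙 :- t :* q) :* (z :* q :* (𝟙 :- c :* q) :+ z :* q :* c :* q :* (𝟙 :- t) :- z :* q :* (𝟙 :- c :* (t :* q)) :* Y :* (𝟙 :- c :* q)) :* ((𝟙 :- z :* q) :* (𝟙 :- c :* q)))
      refl z c q (pow q M) Y

theorem1p2 : {a ℓ : Level} (F : Field a ℓ) →
    let open Field F
        open FieldOps F
    in
    (N : ℕ) (q z c : Carrier) →
    (∀ j → 1 ≤ j → j ≤ N → ¬ (pow q j ≈ 1#)) →
    ¬ (c ≈ 0#) →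
    (∀ n → 1 ≤ n → n ≤ N → ¬ (z * pow q n ≈ 1#)) →
    (∀ n → 1 ≤ n → n ≤ N → ¬ (c * pow q n ≈ 1#)) →
    sum1 N (λ n → qbinom q N n * (pow (- 1#) (n ∸ 1) * pow z n * pow q (tri n) * poch q q n)
                  ÷ ((1# - c * pow q n) * poch q (z * q) n))
      ≈ (z ÷ c) * sum1 N (λ n → qbinom q N n * (poch q (z * q ÷ c) (n ∸ 1) * poch q q n * poch q (c * q) (N ∸ n) * pow (c * q) n)
                  ÷ (poch q (z * q) n * poch q (c * q) N))
theorem1p2 F N q z c hq c≉0 hz hc = begin
  sum1 N (leftTerm N z c)             ≈⟨ leftSum≈ℒ N z c hq hz hc ⟩
  ℒ N z c                             ≈⟨ ℒ≈ℛ N z c hz hc ⟩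
  ℛ N z c                             ≈⟨ rightSum≈ℛ N z c c≉0 hq hz hc ⟨
  (z ÷ c) * sum1 N (rightTerm N z c) ∎
  where
  open Field F
  open FieldOps F
  open QIdentity F q
  open import Relation.Binary.Reasoning.Setoid setoid
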